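{- For $m\geq 2$ and $n\geq 0$, $$X_{L_{m,n}}=(m-1)X_{L_{m-1,n+1}}-(m-2)X_{K_{m-1}}X_{P_{n+1}}.$$
   Context: All graphs are finite and simple. For a graph $G$ with vertex set $\{v_1,\dots,v_N\}$, the chromatic symmetric function is $X_G=\sum_\kappa x_{\kappa(v_1)}\cdots x_{\kappa(v_N)}$, summed over all proper colourings $\kappa:V\to\{1,2,\dots\}$ (adjacent vertices get different colours); $X_\emptyset=1$. $K_m$ ($m\geq1$) is the complete graph on $m$ vertices; $P_n$ ($n\geq1$) is the path on $n$ vertices ($P_1=K_1$). For $m,n\geq 1$ the lollipop graph $L_{m,n}$ is obtained from the disjoint union of $K_m$ and $P_n$ by adding an edge joining one vertex of $K_m$ to an end vertex (degree $\leq 1$ vertex) of $P_n$. Conventions: $K_0=P_0=L_{0,0}=\emptyset$ (empty graph), $L_{m,0}=K_m$, $L_{0,n}=P_n$. -}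

module Defs where

open import Data.Bool using (Bool; true; false; _∧_; _∨_; not; if_then_else_)
open import Data.Nat using (ℕ; zero; suc; _+_; _∸_; _<ᵇ_; _≡ᵇ_)
open import Data.Fin using (Fin; toℕ)
import Data.Fin as F
open import Data.Vec using (Vec; []; _∷_; lookup; tabulate; toList)
open import Data.List using (List; []; _∷_; [_]; map; concatMap; allFin; length; filterᵇ; sum; upTo)
import Data.List as L
open import Data.Bool.ListAction using (and)
open import Data.Integer using (ℤ; +_) renaming (_+_ to _+ℤ_; _*_ to _*ℤ_; _-_ to _-ℤ_)
open import Data.Product using (_×_; _,_)

-- Finite simple graphs on vertex set Fin size, with Boolean adjacency.
-- (All graphs used below are symmetric and irreflexive by construction.)

record Graph : Set where
  field
    size : ℕ
    adj  : Fin size → Fin size → Bool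
open Graph public

consecutive : ℕ → ℕ → Bool
consecutive i j = (suc i ≡ᵇ j) ∨ (suc j ≡ᵇ i)

K : ℕ → Graph
K m = record { size = m ; adj = λ i j → not (toℕ i ≡ᵇ toℕ j) }

P : ℕ → Graph
P n = record { size = n ; adj = λ i j → consecutive (toℕ i) (toℕ j) }

-- Lollipop L_{m,n} on vertices 0..m+n-1: vertices 0..m-1 form K_m,
-- vertices m..m+n-1 form the path P_n (in this order), and the clique
-- vertex m-1 is joined to the path end vertex m.  L_{m,0} = K_m, L_{0,n} = P_n, L_{0,0} = ∅.
lollipopAdj : ℕ → ℕ → ℕ → Bool
lollipopAdj m i j =
  ((i <ᵇ m) ∧ (j <ᵇ m) ∧ not (i ≡ᵇ j))
  ∨ (consecutive i j ∧ not ((i <ᵇ m) ∧ (j <ᵇ m)))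

Lollipop : ℕ → ℕ → Graph
Lollipop m n = record { size = m + n ; adj = λ i j → lollipopAdj m (toℕ i) (toℕ j) }

-- Colourings with colours from {1..k} (encoded as Fin k), as vectors.

allVecs : (N k : ℕ) → List (Vec (Fin k) N)
allVecs zero    k = [ [] ]
allVecs (suc N) k = concatMap (λ c → map (c ∷_) (allVecs N k)) (allFin k)

isProper : (G : Graph) {k : ℕ} → Vec (Fin k) (size G) → Bool
isProper G κ =
  and (concatMap (λ i → map (λ j →
     not (adj G i j ∧ (toℕ (lookup κ i) ≡ᵇ toℕ (lookup κ j))))
     (allFin (size G))) (allFin (size G)))

-- exponent vector of the monomial x_{κ(v_1)} ⋯ x_{κ(v_N)}
colourType : {N k : ℕ} → Vec (Fin k) N → Vec ℕ k
colourType {N} {k} κ = tabulate λ c →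
  length (filterᵇ (λ v → toℕ v ≡ᵇ toℕ c) (toList κ))

vecEqᵇ : {k : ℕ} → Vec ℕ k → Vec ℕ k → Bool
vecEqᵇ []       []       = true
vecEqᵇ (x ∷ xs) (y ∷ ys) = (x ≡ᵇ y) ∧ vecEqᵇ xs ys

-- Formal power series in x_1, x_2, … (integer coefficients), given by
-- their coefficients: a monomial x_1^{a_1} ⋯ x_k^{a_k} (every monomial has
-- finite support, so is of this form for some k) is given by a : Vec ℕ k.
-- (Padding a with zeros gives the same monomial; all series below are
-- consistent under this.)

Series : Set
Series = (k : ℕ) → Vec ℕ k → ℤ

X : Graph → Series
X G k a = + length (filterᵇ (λ κ → isProper G κ ∧ vecEqᵇ (colourType κ) a)
                             (allVecs (size G) k))

splits : {k : ℕ} → Vec ℕ k → List (Vec ℕ k × Vec ℕ k)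
splits []       = [ ([] , []) ]
splits (x ∷ xs) =
  concatMap (λ b → map (λ { (bs , cs) → (b ∷ bs , (x ∸ b) ∷ cs) }) (splits xs))
            (upTo (suc x))

infixl 7 _⊗_ _·_
infixl 6 _⊕_ _⊖_

_⊗_ : Series → Series → Series
(F ⊗ G) k a = L.foldr _+ℤ_ (+ 0) (map (λ { (b , c) → F k b *ℤ G k c }) (splits a))

_⊕_ : Series → Series → Series
(F ⊕ G) k a = F k a +ℤ G k a

_⊖_ : Series → Series → Series
(F ⊖ G) k a = F k a -ℤ G k a

_·_ : ℤ → Series → Series
(z · F) k a = z *ℤ F k a

open import Relation.Binary.PropositionalEquality using (_≡_)
_≈ₛ_ : Series → Series → Set
F ≈ₛ G = (k : ℕ) (a : Vec ℕ k) → F k a ≡ G k a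

-- Write v = m-1 = j+1 and let H = K_v ⊔ P_{n+1} on vertices 0..v+n: the clique
-- on 0..v-1 and the path on v..v+n.  Both lollipops are H plus edges at the
-- path end v:  L_{m,n} = H + {v,i} for all i < v  (a "star"), and
-- L_{m-1,n+1} = H + {j,v}  (a single edge).  Fix a colour type a, write c(G)
-- for the number of proper colourings of G of type a (the coefficient of x^a
-- in X(G)), and let B_i count those of H with κ(i) = κ(v).  As 0..v-1 is a
-- clique, κ(v) agrees with at most one κ(i), i < v, so
--   c(H) = c(L_{m,n}) + Σ_{i<v} B_i,     c(L_{m-1,n+1}) = c(L_{m,n}) + Σ_{i<j} B_i,
-- and B_i does not depend on i, because transposing two clique vertices is an
-- automorphism of H.  Eliminating B gives  c(L_{m,n}) + j c(H) = (j+1) c(L_{m-1,n+1})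
-- (lemma `clique-attachment`, proved for any graph with such a clique), and
-- c(H) is the coefficient of x^a in X(K_v) X(P_{n+1}) because X is
-- multiplicative on disjoint unions (lemma `X-disjoint-union`).

module Submission where

open import Defs
open import Data.Bool using (Bool; true; false; _∧_; _∨_; not)
open import Data.Bool.Properties using (T-≡; ∧-commutativeMonoid; ∧-zeroʳ; ∧-identityʳ; ∨-zeroʳ; ∨-identityʳ; not-involutive)
open import Data.Bool.ListAction using (and)
open import Data.Nat using (ℕ; zero; suc; _+_; _*_; _∸_; _<ᵇ_; _≡ᵇ_; _<_; _≤_; z≤n; s≤s; z<s)
open import Data.Nat.Properties
open import Data.Nat.Tactic.RingSolver using (solve-∀)
open import Algebra.Bundles using (CommutativeMonoid)
import Algebra.Properties.CommutativeSemigroup as CommutativeSemigroupProperties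
open import Data.Integer using (ℤ) renaming (+_ to pos; -_ to -ℤ_; _+_ to _+ℤ_; _*_ to _*ℤ_; _-_ to _-ℤ_)
import Data.Integer.Properties as ℤ
open import Data.Fin using (Fin; toℕ; fromℕ<)
import Data.Fin as Fin
open import Data.Fin.Properties using (toℕ<n; toℕ-fromℕ<)
open import Data.Vec using (Vec; []; _∷_; lookup; tabulate; toList; _++_; zipWith)
open import Data.Vec.Properties using (tabulate-cong)
open import Data.List using (List; []; _∷_; map; concatMap; allFin; length; filterᵇ; upTo)
import Data.List as List
open import Data.List.Properties using (map-applyUpTo)
open import Data.List.Membership.Propositional using (_∈_; lose; find)
open import Data.List.Membership.Propositional.Properties using (∈-concatMap⁺; ∈-concatMap⁻; ∈-map⁺; ∈-map⁻; ∈-allFin)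
open import Data.List.Relation.Unary.Any using (here; there)
open import Data.Product using (_×_; _,_; proj₁; proj₂)
open import Data.Sum using (_⊎_; inj₁; inj₂)
open import Data.Empty using (⊥; ⊥-elim)
open import Function using (Equivalence)
open import Relation.Binary.PropositionalEquality
open ≡-Reasoning

open CommutativeSemigroupProperties +-commutativeSemigroup
  using () renaming (interchange to +-interchange; x∙yz≈y∙xz to +-exchange)
open CommutativeSemigroupProperties *-commutativeSemigroup
  using () renaming (interchange to *-interchange)
open CommutativeSemigroupProperties (CommutativeMonoid.commutativeSemigroup ∧-commutativeMonoid)
  using () renaming (xy∙z≈xz∙y to ∧-swapʳ)

⟦_⟧ : Bool → ℕ
⟦ true ⟧  = 1
⟦ false ⟧ = 0

⟦∧⟧ : ∀ a b → ⟦ a ∧ b ⟧ ≡ ⟦ a ⟧ * ⟦ b ⟧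
⟦∧⟧ true  b = sym (+-identityʳ ⟦ b ⟧)
⟦∧⟧ false b = refl

∑ : {A : Set} → List A → (A → ℕ) → ℕ
∑ []       f = 0
∑ (x ∷ xs) f = f x + ∑ xs f

∑-cong : {A : Set} (xs : List A) {f g : A → ℕ} → (∀ x → f x ≡ g x) → ∑ xs f ≡ ∑ xs g
∑-cong []       e = refl
∑-cong (x ∷ xs) e = cong₂ _+_ (e x) (∑-cong xs e)

∑-0 : {A : Set} (xs : List A) → ∑ xs (λ _ → 0) ≡ 0
∑-0 []       = refl
∑-0 (x ∷ xs) = ∑-0 xs

∑-+ : {A : Set} (xs : List A) (f g : A → ℕ) → ∑ xs (λ x → f x + g x) ≡ ∑ xs f + ∑ xs g
∑-+ []       f g = refl
∑-+ (x ∷ xs) f g = begin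
  f x + g x + ∑ xs (λ x → f x + g x) ≡⟨ cong (f x + g x +_) (∑-+ xs f g) ⟩
  f x + g x + (∑ xs f + ∑ xs g)      ≡⟨ +-interchange (f x) (g x) _ _ ⟩
  f x + ∑ xs f + (g x + ∑ xs g)      ∎

∑-*ˡ : {A : Set} (xs : List A) (c : ℕ) (f : A → ℕ) → ∑ xs (λ x → c * f x) ≡ c * ∑ xs f
∑-*ˡ []       c f = sym (*-zeroʳ c)
∑-*ˡ (x ∷ xs) c f = trans (cong (c * f x +_) (∑-*ˡ xs c f)) (sym (*-distribˡ-+ c (f x) _))

∑-comm : {A B : Set} (xs : List A) (ys : List B) (f : A → B → ℕ) →
  ∑ xs (λ x → ∑ ys (f x)) ≡ ∑ ys (λ y → ∑ xs (λ x → f x y))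
∑-comm []       ys f = sym (∑-0 ys)
∑-comm (x ∷ xs) ys f = trans (cong (∑ ys (f x) +_) (∑-comm xs ys f)) (sym (∑-+ ys (f x) _))

∑-*-∑ : {A B : Set} (xs : List A) (ys : List B) (f : A → ℕ) (g : B → ℕ) →
  ∑ xs f * ∑ ys g ≡ ∑ xs (λ x → ∑ ys (λ y → f x * g y))
∑-*-∑ xs ys f g = begin
  ∑ xs f * ∑ ys g                       ≡⟨ *-comm (∑ xs f) _ ⟩
  ∑ ys g * ∑ xs f                       ≡⟨ sym (∑-*ˡ xs (∑ ys g) f) ⟩
  ∑ xs (λ x → ∑ ys g * f x)             ≡⟨ ∑-cong xs (λ x → *-comm (∑ ys g) (f x)) ⟩
  ∑ xs (λ x → f x * ∑ ys g)             ≡⟨ ∑-cong xs (λ x → sym (∑-*ˡ ys (f x) g)) ⟩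
  ∑ xs (λ x → ∑ ys (λ y → f x * g y))   ∎

∑-map : {A B : Set} (g : A → B) (xs : List A) (f : B → ℕ) → ∑ (map g xs) f ≡ ∑ xs (λ x → f (g x))
∑-map g []       f = refl
∑-map g (x ∷ xs) f = cong (f (g x) +_) (∑-map g xs f)

∑-++ : {A : Set} (xs ys : List A) (f : A → ℕ) → ∑ (xs List.++ ys) f ≡ ∑ xs f + ∑ ys f
∑-++ []       ys f = refl
∑-++ (x ∷ xs) ys f = trans (cong (f x +_) (∑-++ xs ys f)) (sym (+-assoc (f x) _ _))

∑-concatMap : {A B : Set} (g : A → List B) (xs : List A) (f : B → ℕ) →
  ∑ (concatMap g xs) f ≡ ∑ xs (λ x → ∑ (g x) f)
∑-concatMap g []       f = refl
∑-concatMap g (x ∷ xs) f =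
  trans (∑-++ (g x) (concatMap g xs) f) (cong (∑ (g x) f +_) (∑-concatMap g xs f))

length-filter : {A : Set} (p : A → Bool) (xs : List A) → length (filterᵇ p xs) ≡ ∑ xs (λ x → ⟦ p x ⟧)
length-filter p []       = refl
length-filter p (x ∷ xs) with p x
... | true  = cong suc (length-filter p xs)
... | false = length-filter p xs

∑ⱽ : {k : ℕ} (N : ℕ) → (Vec (Fin k) N → ℕ) → ℕ
∑ⱽ {k} N f = ∑ (allVecs N k) f

∑ⱽ-suc : {k : ℕ} (N : ℕ) (f : Vec (Fin k) (suc N) → ℕ) →
  ∑ⱽ (suc N) f ≡ ∑ (allFin k) (λ c → ∑ⱽ N (λ κ → f (c ∷ κ)))
∑ⱽ-suc {k} N f = trans (∑-concatMap _ (allFin k) f)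
                       (∑-cong (allFin k) (λ c → ∑-map (c ∷_) (allVecs N k) f))

∑ⱽ-++ : {k : ℕ} (N₁ N₂ : ℕ) (f : Vec (Fin k) (N₁ + N₂) → ℕ) →
  ∑ⱽ (N₁ + N₂) f ≡ ∑ⱽ N₁ (λ u → ∑ⱽ N₂ (λ w → f (u ++ w)))
∑ⱽ-++ zero N₂ f = sym (+-identityʳ _)
∑ⱽ-++ {k} (suc N₁) N₂ f = begin
  ∑ⱽ (suc N₁ + N₂) f
    ≡⟨ ∑ⱽ-suc (N₁ + N₂) f ⟩
  ∑ (allFin k) (λ c → ∑ⱽ (N₁ + N₂) (λ κ → f (c ∷ κ)))
    ≡⟨ ∑-cong (allFin k) (λ c → ∑ⱽ-++ N₁ N₂ (λ κ → f (c ∷ κ))) ⟩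
  ∑ (allFin k) (λ c → ∑ⱽ N₁ (λ u → ∑ⱽ N₂ (λ w → f (c ∷ u ++ w))))
    ≡⟨ sym (∑ⱽ-suc {k} N₁ _) ⟩
  ∑ⱽ (suc N₁) (λ u → ∑ⱽ N₂ (λ w → f (u ++ w))) ∎

swapAt : {A : Set} {N : ℕ} → ℕ → Vec A N → Vec A N
swapAt zero    (x ∷ y ∷ xs) = y ∷ x ∷ xs
swapAt (suc i) (x ∷ xs)     = x ∷ swapAt i xs
swapAt _       xs           = xs

∑ⱽ-swap : {k : ℕ} (N i : ℕ) (f : Vec (Fin k) N → ℕ) → ∑ⱽ N f ≡ ∑ⱽ N (λ κ → f (swapAt i κ))
∑ⱽ-swap zero          zero    f = refl
∑ⱽ-swap zero          (suc i) f = refl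
∑ⱽ-swap (suc zero)    zero    f = trans (∑ⱽ-suc zero f) (sym (∑ⱽ-suc zero (λ κ → f (swapAt zero κ))))
∑ⱽ-swap {k} (suc (suc N)) zero f = begin
  ∑ⱽ (suc (suc N)) f                                          ≡⟨ first-two f ⟩
  ∑ (allFin k) (λ c → ∑ (allFin k) (λ d → ∑ⱽ N (λ κ → f (c ∷ d ∷ κ))))
    ≡⟨ ∑-comm (allFin k) (allFin k) _ ⟩
  ∑ (allFin k) (λ d → ∑ (allFin k) (λ c → ∑ⱽ N (λ κ → f (c ∷ d ∷ κ))))
    ≡⟨ sym (first-two (λ κ → f (swapAt zero κ))) ⟩
  ∑ⱽ (suc (suc N)) (λ κ → f (swapAt zero κ))                  ∎
  where
  first-two : (g : Vec (Fin k) (suc (suc N)) → ℕ) →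
    ∑ⱽ (suc (suc N)) g ≡ ∑ (allFin k) (λ c → ∑ (allFin k) (λ d → ∑ⱽ N (λ κ → g (c ∷ d ∷ κ))))
  first-two g = trans (∑ⱽ-suc (suc N) g) (∑-cong (allFin k) (λ c → ∑ⱽ-suc {k} N _))
∑ⱽ-swap {k} (suc N)   (suc i) f = begin
  ∑ⱽ (suc N) f                                                ≡⟨ ∑ⱽ-suc N f ⟩
  ∑ (allFin k) (λ c → ∑ⱽ N (λ κ → f (c ∷ κ)))
    ≡⟨ ∑-cong (allFin k) (λ c → ∑ⱽ-swap N i (λ κ → f (c ∷ κ))) ⟩
  ∑ (allFin k) (λ c → ∑ⱽ N (λ κ → f (c ∷ swapAt i κ)))        ≡⟨ sym (∑ⱽ-suc {k} N _) ⟩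
  ∑ⱽ (suc N) (λ κ → f (swapAt (suc i) κ))                     ∎

∑< : ℕ → (ℕ → ℕ) → ℕ
∑< zero    f = 0
∑< (suc r) f = ∑< r f + f r

∑<-cong : ∀ r {f g : ℕ → ℕ} → (∀ i → i < r → f i ≡ g i) → ∑< r f ≡ ∑< r g
∑<-cong zero    e = refl
∑<-cong (suc r) e = cong₂ _+_ (∑<-cong r (λ i i<r → e i (m<n⇒m<1+n i<r))) (e r ≤-refl)

∑<-const : ∀ r (f : ℕ → ℕ) c → (∀ i → i < r → f i ≡ c) → ∑< r f ≡ r * c
∑<-const zero    f c e = refl
∑<-const (suc r) f c e =
  trans (cong₂ _+_ (∑<-const r f c (λ i i<r → e i (m<n⇒m<1+n i<r))) (e r ≤-refl)) (+-comm (r * c) c)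

∑<-0 : ∀ r → ∑< r (λ _ → 0) ≡ 0
∑<-0 r = trans (∑<-const r _ 0 (λ _ _ → refl)) (*-zeroʳ r)

∑-∑< : {A : Set} (xs : List A) (r : ℕ) (f : ℕ → A → ℕ) →
  ∑ xs (λ x → ∑< r (λ i → f i x)) ≡ ∑< r (λ i → ∑ xs (f i))
∑-∑< xs zero    f = ∑-0 xs
∑-∑< xs (suc r) f = trans (∑-+ xs _ (f r)) (cong (_+ ∑ xs (f r)) (∑-∑< xs r f))

-- The graph on vertices 0..N-1 with adjacency A, read on natural numbers.
-- K m, P n and Lollipop m n are all of this form (definitionally).
graphOn : ℕ → (ℕ → ℕ → Bool) → Graph
graphOn N A = record { size = N ; adj = λ i j → A (toℕ i) (toℕ j) }

-- The colour of vertex x, as a number (0 outside the vertex range).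
colourOf : {k N : ℕ} → Vec (Fin k) N → ℕ → ℕ
colourOf []       x       = 0
colourOf (c ∷ κ)  zero    = toℕ c
colourOf (c ∷ κ)  (suc x) = colourOf κ x

toℕ-lookup : {k N : ℕ} (κ : Vec (Fin k) N) (i : Fin N) → toℕ (lookup κ i) ≡ colourOf κ (toℕ i)
toℕ-lookup (c ∷ κ) Fin.zero    = refl
toℕ-lookup (c ∷ κ) (Fin.suc i) = toℕ-lookup κ i

Proper : ℕ → (ℕ → ℕ → Bool) → (ℕ → ℕ) → Set
Proper N A g = ∀ x y → x < N → y < N → A x y ≡ true → g x ≢ g y

bool-ext : (a b : Bool) → (a ≡ true → b ≡ true) → (b ≡ true → a ≡ true) → a ≡ b
bool-ext true  b     a⇒b b⇒a = sym (a⇒b refl)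
bool-ext false true  a⇒b b⇒a = b⇒a refl
bool-ext false false a⇒b b⇒a = refl

false≢true : false ≢ true
false≢true ()

∧-intro : ∀ {a b} → a ≡ true → b ≡ true → (a ∧ b) ≡ true
∧-intro refl refl = refl

∧-elimˡ : ∀ {a b} → (a ∧ b) ≡ true → a ≡ true
∧-elimˡ {true} _ = refl

∧-elimʳ : ∀ {a b} → (a ∧ b) ≡ true → b ≡ true
∧-elimʳ {true} ab = ab

≡ᵇ⇒≡′ : ∀ m n → (m ≡ᵇ n) ≡ true → m ≡ n
≡ᵇ⇒≡′ m n e = ≡ᵇ⇒≡ m n (Equivalence.from T-≡ e)

≡⇒≡ᵇ′ : ∀ m n → m ≡ n → (m ≡ᵇ n) ≡ true
≡⇒≡ᵇ′ m n e = Equivalence.to T-≡ (≡⇒≡ᵇ m n e)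

≢⇒≡ᵇ-false : ∀ m n → m ≢ n → (m ≡ᵇ n) ≡ false
≢⇒≡ᵇ-false m n m≢n with m ≡ᵇ n in e
... | false = refl
... | true  = ⊥-elim (m≢n (≡ᵇ⇒≡′ m n e))

<ᵇ⇒<′ : ∀ m n → (m <ᵇ n) ≡ true → m < n
<ᵇ⇒<′ m n e = <ᵇ⇒< m n (Equivalence.from T-≡ e)

<⇒<ᵇ′ : ∀ {m n} → m < n → (m <ᵇ n) ≡ true
<⇒<ᵇ′ m<n = Equivalence.to T-≡ (<⇒<ᵇ m<n)

≥⇒<ᵇ-false : ∀ {m n} → n ≤ m → (m <ᵇ n) ≡ false
≥⇒<ᵇ-false {m} {n} n≤m with m <ᵇ n in e
... | false = refl
... | true  = ⊥-elim (<⇒≱ (<ᵇ⇒<′ m n e) n≤m)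

<ᵇ-false⇒≥ : ∀ m n → (m <ᵇ n) ≡ false → n ≤ m
<ᵇ-false⇒≥ m n e = ≮⇒≥ (λ m<n → false≢true (trans (sym e) (<⇒<ᵇ′ m<n)))

∨-elim : ∀ a {b} → (a ∨ b) ≡ true → (a ≡ true) ⊎ (b ≡ true)
∨-elim true  _  = inj₁ refl
∨-elim false ab = inj₂ ab

and-true : (bs : List Bool) → and bs ≡ true → ∀ {b} → b ∈ bs → b ≡ true
and-true (true  ∷ bs) e (here refl) = refl
and-true (true  ∷ bs) e (there b∈) = and-true bs e b∈

and-intro : (bs : List Bool) → (∀ {b} → b ∈ bs → b ≡ true) → and bs ≡ true
and-intro []       h = refl
and-intro (b ∷ bs) h rewrite h (here refl) = and-intro bs (λ b∈ → h (there b∈))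

module _ {k : ℕ} (N : ℕ) (A : ℕ → ℕ → Bool) (κ : Vec (Fin k) N) where

  private
    edgeOk : Fin N → Fin N → Bool
    edgeOk i j = not (A (toℕ i) (toℕ j) ∧ (toℕ (lookup κ i) ≡ᵇ toℕ (lookup κ j)))

    allTests : List Bool
    allTests = concatMap (λ i → map (edgeOk i) (allFin N)) (allFin N)

  isProper⇒Proper : isProper (graphOn N A) κ ≡ true → Proper N A (colourOf κ)
  isProper⇒Proper ok x y x<N y<N axy same = false≢true (trans (sym test-fails) test-holds)
    where
    i j : Fin N
    i = fromℕ< x<N
    j = fromℕ< y<N
    test-holds : edgeOk i j ≡ true
    test-holds = and-true allTests ok
      (∈-concatMap⁺ (λ i → map (edgeOk i) (allFin N)) (lose (∈-allFin i) (∈-map⁺ (edgeOk i) (∈-allFin j))))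
    test-fails : edgeOk i j ≡ false
    test-fails rewrite toℕ-lookup κ i | toℕ-lookup κ j | toℕ-fromℕ< x<N | toℕ-fromℕ< y<N
                     | axy | ≡⇒≡ᵇ′ _ _ same = refl

  Proper⇒isProper : Proper N A (colourOf κ) → isProper (graphOn N A) κ ≡ true
  Proper⇒isProper proper = and-intro allTests member
    where
    test : ∀ i j → edgeOk i j ≡ true
    test i j with A (toℕ i) (toℕ j) in adjacent
    ... | false = refl
    ... | true with toℕ (lookup κ i) ≡ᵇ toℕ (lookup κ j) in same
    ... | false = refl
    ... | true  = ⊥-elim (proper (toℕ i) (toℕ j) (toℕ<n i) (toℕ<n j) adjacent
                    (trans (sym (toℕ-lookup κ i)) (trans (≡ᵇ⇒≡′ _ _ same) (toℕ-lookup κ j))))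
    member : ∀ {b} → b ∈ allTests → b ≡ true
    member b∈ with find (∈-concatMap⁻ (λ i → map (edgeOk i) (allFin N)) {xs = allFin N} b∈)
    ... | i , _ , b∈row with ∈-map⁻ (edgeOk i) b∈row
    ... | j , _ , refl = test i j

proper-∪ : {k : ℕ} (N : ℕ) (A E A∪E : ℕ → ℕ → Bool) → (∀ x y → A∪E x y ≡ (A x y ∨ E x y)) →
  (κ : Vec (Fin k) N) →
  isProper (graphOn N A∪E) κ ≡ (isProper (graphOn N A) κ ∧ isProper (graphOn N E) κ)
proper-∪ N A E A∪E union κ = bool-ext _ _ split join
  where
  split : isProper (graphOn N A∪E) κ ≡ true →
          (isProper (graphOn N A) κ ∧ isProper (graphOn N E) κ) ≡ true
  split ok = ∧-intro (Proper⇒isProper N A κ (λ x y x< y< a → proper x y x< y< (via-A x y a)))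
                     (Proper⇒isProper N E κ (λ x y x< y< e → proper x y x< y< (via-E x y e)))
    where
    proper : Proper N A∪E (colourOf κ)
    proper = isProper⇒Proper N A∪E κ ok
    via-A : ∀ x y → A x y ≡ true → A∪E x y ≡ true
    via-A x y a rewrite union x y | a = refl
    via-E : ∀ x y → E x y ≡ true → A∪E x y ≡ true
    via-E x y e rewrite union x y | e = ∨-zeroʳ (A x y)
  join : (isProper (graphOn N A) κ ∧ isProper (graphOn N E) κ) ≡ true →
         isProper (graphOn N A∪E) κ ≡ true
  join ok = Proper⇒isProper N A∪E κ proper
    where
    proper : Proper N A∪E (colourOf κ)
    proper x y x< y< adj with A x y in a | E x y in e
    ... | true  | _     = isProper⇒Proper N A κ (∧-elimˡ ok) x y x< y< a
    ... | false | true  = isProper⇒Proper N E κ (∧-elimʳ ok) x y x< y< e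
    ... | false | false = ⊥-elim (false≢true (trans (sym (cong₂ _∨_ a e)) (trans (sym (union x y)) adj)))

colourCount : {k N : ℕ} → Fin k → Vec (Fin k) N → ℕ
colourCount c []      = 0
colourCount c (x ∷ κ) = ⟦ toℕ x ≡ᵇ toℕ c ⟧ + colourCount c κ

colourType-count : {k N : ℕ} (κ : Vec (Fin k) N) → colourType κ ≡ tabulate (λ c → colourCount c κ)
colourType-count κ = tabulate-cong (λ c → trans (length-filter _ (toList κ)) (count-list c κ))
  where
  count-list : ∀ {k N} (c : Fin k) (κ : Vec (Fin k) N) →
    ∑ (toList κ) (λ x → ⟦ toℕ x ≡ᵇ toℕ c ⟧) ≡ colourCount c κ
  count-list c []      = refl
  count-list c (x ∷ κ) = cong (⟦ toℕ x ≡ᵇ toℕ c ⟧ +_) (count-list c κ)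

_+ᵛ_ : {k : ℕ} → Vec ℕ k → Vec ℕ k → Vec ℕ k
_+ᵛ_ = zipWith _+_

+ᵛ-tabulate : {k : ℕ} (f g : Fin k → ℕ) → tabulate f +ᵛ tabulate g ≡ tabulate (λ c → f c + g c)
+ᵛ-tabulate {zero}  f g = refl
+ᵛ-tabulate {suc k} f g = cong (f Fin.zero + g Fin.zero ∷_) (+ᵛ-tabulate (λ c → f (Fin.suc c)) (λ c → g (Fin.suc c)))

colourType-++ : {k N₁ N₂ : ℕ} (u : Vec (Fin k) N₁) (w : Vec (Fin k) N₂) →
  colourType (u ++ w) ≡ colourType u +ᵛ colourType w
colourType-++ {k} u w = begin
  colourType (u ++ w)                                   ≡⟨ colourType-count (u ++ w) ⟩
  tabulate (λ c → colourCount c (u ++ w))               ≡⟨ tabulate-cong (λ c → count-++ c u) ⟩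
  tabulate (λ c → colourCount c u + colourCount c w)    ≡⟨ sym (+ᵛ-tabulate _ _) ⟩
  tabulate (λ c → colourCount c u) +ᵛ tabulate (λ c → colourCount c w)
    ≡⟨ sym (cong₂ _+ᵛ_ (colourType-count u) (colourType-count w)) ⟩
  colourType u +ᵛ colourType w                           ∎
  where
  count-++ : ∀ {N₁} (c : Fin k) (u : Vec (Fin k) N₁) → colourCount c (u ++ w) ≡ colourCount c u + colourCount c w
  count-++ c []      = refl
  count-++ c (x ∷ u) = trans (cong (⟦ toℕ x ≡ᵇ toℕ c ⟧ +_) (count-++ c u)) (sym (+-assoc ⟦ toℕ x ≡ᵇ toℕ c ⟧ _ _))

colourType-swap : {k N : ℕ} (i : ℕ) (κ : Vec (Fin k) N) → colourType (swapAt i κ) ≡ colourType κ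
colourType-swap i κ = begin
  colourType (swapAt i κ)                       ≡⟨ colourType-count (swapAt i κ) ⟩
  tabulate (λ c → colourCount c (swapAt i κ))   ≡⟨ tabulate-cong (λ c → count-swap c i κ) ⟩
  tabulate (λ c → colourCount c κ)              ≡⟨ sym (colourType-count κ) ⟩
  colourType κ                                  ∎
  where
  count-swap : ∀ {k N} (c : Fin k) i (κ : Vec (Fin k) N) → colourCount c (swapAt i κ) ≡ colourCount c κ
  count-swap c zero    []          = refl
  count-swap c zero    (x ∷ [])    = refl
  count-swap c zero    (x ∷ y ∷ κ) = +-exchange ⟦ toℕ y ≡ᵇ toℕ c ⟧ ⟦ toℕ x ≡ᵇ toℕ c ⟧ (colourCount c κ)
  count-swap c (suc i) []          = refl
  count-swap c (suc i) (x ∷ κ)     = cong (⟦ toℕ x ≡ᵇ toℕ c ⟧ +_) (count-swap c i κ)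

τ : ℕ → ℕ → ℕ
τ zero    zero          = 1
τ zero    (suc zero)    = 0
τ zero    x             = x
τ (suc i) zero          = zero
τ (suc i) (suc x)       = suc (τ i x)

τ-involutive : ∀ i x → τ i (τ i x) ≡ x
τ-involutive zero    zero          = refl
τ-involutive zero    (suc zero)    = refl
τ-involutive zero    (suc (suc x)) = refl
τ-involutive (suc i) zero          = refl
τ-involutive (suc i) (suc x)       = cong suc (τ-involutive i x)

τ-< : ∀ i x N → suc i < N → x < N → τ i x < N
τ-< zero    zero          N     i<N       _         = i<N
τ-< zero    (suc zero)    N     i<N       _         = <-trans z<s i<N
τ-< zero    (suc (suc x)) N     _         x<N       = x<N
τ-< (suc i) zero          N     _         x<N       = x<N
τ-< (suc i) (suc x)       (suc N) (s≤s i<N) (s≤s x<N) = s≤s (τ-< i x N i<N x<N)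

τ-left : ∀ i → τ i (suc i) ≡ i
τ-left zero    = refl
τ-left (suc i) = cong suc (τ-left i)

τ-fixes : ∀ i x → x ≢ i → x ≢ suc i → τ i x ≡ x
τ-fixes zero    zero          x≢i x≢1+i = ⊥-elim (x≢i refl)
τ-fixes zero    (suc zero)    x≢i x≢1+i = ⊥-elim (x≢1+i refl)
τ-fixes zero    (suc (suc x)) x≢i x≢1+i = refl
τ-fixes (suc i) zero          x≢i x≢1+i = refl
τ-fixes (suc i) (suc x)       x≢i x≢1+i =
  cong suc (τ-fixes i x (λ e → x≢i (cong suc e)) (λ e → x≢1+i (cong suc e)))

colourOf-swap : {k N : ℕ} (i x : ℕ) (κ : Vec (Fin k) N) → suc i < N →
  colourOf (swapAt i κ) x ≡ colourOf κ (τ i x)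
colourOf-swap zero    x             (a ∷ [])    (s≤s ())
colourOf-swap zero    zero          (a ∷ b ∷ κ) _         = refl
colourOf-swap zero    (suc zero)    (a ∷ b ∷ κ) _         = refl
colourOf-swap zero    (suc (suc x)) (a ∷ b ∷ κ) _         = refl
colourOf-swap (suc i) zero          (a ∷ κ)     _         = refl
colourOf-swap (suc i) (suc x)       (a ∷ κ)     (s≤s i<N) = colourOf-swap i x κ i<N

proper-swap : {k : ℕ} (N : ℕ) (A : ℕ → ℕ → Bool) (i : ℕ) → suc i < N →
  (∀ x y → A (τ i x) (τ i y) ≡ A x y) → (κ : Vec (Fin k) N) →
  isProper (graphOn N A) (swapAt i κ) ≡ isProper (graphOn N A) κ
proper-swap N A i i<N automorphism κ = bool-ext _ _ unswap swap
  where
  colour-τ : ∀ x → colourOf κ x ≡ colourOf (swapAt i κ) (τ i x)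
  colour-τ x = sym (trans (colourOf-swap i (τ i x) κ i<N) (cong (colourOf κ) (τ-involutive i x)))
  unswap : isProper (graphOn N A) (swapAt i κ) ≡ true → isProper (graphOn N A) κ ≡ true
  unswap ok = Proper⇒isProper N A κ λ x y x<N y<N adj same →
    isProper⇒Proper N A (swapAt i κ) ok (τ i x) (τ i y) (τ-< i x N i<N x<N) (τ-< i y N i<N y<N)
      (trans (automorphism x y) adj) (trans (sym (colour-τ x)) (trans same (colour-τ y)))
  swap : isProper (graphOn N A) κ ≡ true → isProper (graphOn N A) (swapAt i κ) ≡ true
  swap ok = Proper⇒isProper N A (swapAt i κ) λ x y x<N y<N adj same →
    isProper⇒Proper N A κ ok (τ i x) (τ i y) (τ-< i x N i<N x<N) (τ-< i y N i<N y<N)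
      (trans (automorphism x y) adj)
      (trans (sym (colourOf-swap i x κ i<N)) (trans same (colourOf-swap i y κ i<N)))

-- Disjoint unions: X is multiplicative

disjointAdj : ℕ → (ℕ → ℕ → Bool) → (ℕ → ℕ → Bool) → ℕ → ℕ → Bool
disjointAdj N₁ A₁ A₂ x y =
  ((x <ᵇ N₁) ∧ (y <ᵇ N₁) ∧ A₁ x y) ∨ (not (x <ᵇ N₁) ∧ not (y <ᵇ N₁) ∧ A₂ (x ∸ N₁) (y ∸ N₁))

colourOf-++ˡ : {k N₁ N₂ : ℕ} (u : Vec (Fin k) N₁) (w : Vec (Fin k) N₂) (x : ℕ) → x < N₁ →
  colourOf (u ++ w) x ≡ colourOf u x
colourOf-++ˡ (c ∷ u) w zero    _         = refl
colourOf-++ˡ (c ∷ u) w (suc x) (s≤s x<N) = colourOf-++ˡ u w x x<N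

colourOf-++ʳ : {k N₁ N₂ : ℕ} (u : Vec (Fin k) N₁) (w : Vec (Fin k) N₂) (x : ℕ) → N₁ ≤ x →
  colourOf (u ++ w) x ≡ colourOf w (x ∸ N₁)
colourOf-++ʳ []      w x       _         = refl
colourOf-++ʳ (c ∷ u) w (suc x) (s≤s N≤x) = colourOf-++ʳ u w x N≤x

module _ {k : ℕ} (N₁ N₂ : ℕ) (A₁ A₂ : ℕ → ℕ → Bool) (u : Vec (Fin k) N₁) (w : Vec (Fin k) N₂) where

  private
    D : ℕ → ℕ → Bool
    D = disjointAdj N₁ A₁ A₂

  proper-disjointˡ : isProper (graphOn (N₁ + N₂) D) (u ++ w) ≡ true → isProper (graphOn N₁ A₁) u ≡ true
  proper-disjointˡ ok = Proper⇒isProper N₁ A₁ u λ x y x< y< a same →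
    isProper⇒Proper (N₁ + N₂) D (u ++ w) ok x y (<-≤-trans x< (m≤m+n N₁ N₂)) (<-≤-trans y< (m≤m+n N₁ N₂))
      (adjacent x y x< y< a) (trans (colourOf-++ˡ u w x x<) (trans same (sym (colourOf-++ˡ u w y y<))))
    where
    adjacent : ∀ x y → x < N₁ → y < N₁ → A₁ x y ≡ true → D x y ≡ true
    adjacent x y x< y< a rewrite <⇒<ᵇ′ x< | <⇒<ᵇ′ y< | a = refl

  proper-disjointʳ : isProper (graphOn (N₁ + N₂) D) (u ++ w) ≡ true → isProper (graphOn N₂ A₂) w ≡ true
  proper-disjointʳ ok = Proper⇒isProper N₂ A₂ w λ x y x< y< a same →
    isProper⇒Proper (N₁ + N₂) D (u ++ w) ok (N₁ + x) (N₁ + y) (+-monoʳ-< N₁ x<) (+-monoʳ-< N₁ y<)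
      (adjacent x y a) (trans (colour x) (trans same (sym (colour y))))
    where
    colour : ∀ x → colourOf (u ++ w) (N₁ + x) ≡ colourOf w x
    colour x = trans (colourOf-++ʳ u w (N₁ + x) (m≤m+n N₁ x)) (cong (colourOf w) (m+n∸m≡n N₁ x))
    adjacent : ∀ x y → A₂ x y ≡ true → D (N₁ + x) (N₁ + y) ≡ true
    adjacent x y a rewrite ≥⇒<ᵇ-false {N₁ + x} {N₁} (m≤m+n N₁ x) | ≥⇒<ᵇ-false {N₁ + y} {N₁} (m≤m+n N₁ y)
                         | m+n∸m≡n N₁ x | m+n∸m≡n N₁ y | a = refl

  proper-disjoint-join : isProper (graphOn N₁ A₁) u ≡ true → isProper (graphOn N₂ A₂) w ≡ true →
    isProper (graphOn (N₁ + N₂) D) (u ++ w) ≡ true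
  proper-disjoint-join ok₁ ok₂ = Proper⇒isProper (N₁ + N₂) D (u ++ w) proper
    where
    below : ∀ x → x < N₁ + N₂ → N₁ ≤ x → x ∸ N₁ < N₂
    below x x< N≤x = subst (x ∸ N₁ <_) (m+n∸m≡n N₁ N₂) (∸-monoˡ-< x< N≤x)
    proper : Proper (N₁ + N₂) D (colourOf (u ++ w))
    proper x y x< y< d same with x <ᵇ N₁ in ex | y <ᵇ N₁ in ey
    ... | true  | true  =
      isProper⇒Proper N₁ A₁ u ok₁ x y (<ᵇ⇒<′ x N₁ ex) (<ᵇ⇒<′ y N₁ ey) (trans (sym (∨-identityʳ (A₁ x y))) d)
        (trans (sym (colourOf-++ˡ u w x (<ᵇ⇒<′ x N₁ ex))) (trans same (colourOf-++ˡ u w y (<ᵇ⇒<′ y N₁ ey))))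
    ... | true  | false = ⊥-elim (false≢true d)
    ... | false | true  = ⊥-elim (false≢true d)
    ... | false | false =
      isProper⇒Proper N₂ A₂ w ok₂ (x ∸ N₁) (y ∸ N₁)
        (below x x< (<ᵇ-false⇒≥ x N₁ ex)) (below y y< (<ᵇ-false⇒≥ y N₁ ey)) d
        (trans (sym (colourOf-++ʳ u w x (<ᵇ-false⇒≥ x N₁ ex))) (trans same (colourOf-++ʳ u w y (<ᵇ-false⇒≥ y N₁ ey))))

  proper-disjoint : isProper (graphOn (N₁ + N₂) D) (u ++ w) ≡ (isProper (graphOn N₁ A₁) u ∧ isProper (graphOn N₂ A₂) w)
  proper-disjoint = bool-ext _ _ (λ ok → ∧-intro (proper-disjointˡ ok) (proper-disjointʳ ok))
                                 (λ ok → proper-disjoint-join (∧-elimˡ ok) (∧-elimʳ ok))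

properOfType : (N : ℕ) (A : ℕ → ℕ → Bool) {k : ℕ} (a : Vec ℕ k) → Vec (Fin k) N → Bool
properOfType N A a κ = isProper (graphOn N A) κ ∧ vecEqᵇ (colourType κ) a

#proper : (N : ℕ) (A : ℕ → ℕ → Bool) (k : ℕ) (a : Vec ℕ k) → ℕ
#proper N A k a = ∑ⱽ N (λ κ → ⟦ properOfType N A a κ ⟧)

X-#proper : (N : ℕ) (A : ℕ → ℕ → Bool) (k : ℕ) (a : Vec ℕ k) → X (graphOn N A) k a ≡ pos (#proper N A k a)
X-#proper N A k a = cong pos (length-filter _ (allVecs N k))

∑-upTo-suc : ∀ n (h : ℕ → ℕ) → ∑ (upTo (suc n)) h ≡ h 0 + ∑ (upTo n) (λ b → h (suc b))
∑-upTo-suc n h = cong (h 0 +_) (trans (cong (λ bs → ∑ bs h) (sym (map-applyUpTo (λ b → b) suc n)))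
                                      (∑-map suc (upTo n) h))

∑-upTo-indicator : ∀ n u (h : ℕ → ℕ) → ∑ (upTo n) (λ b → ⟦ u ≡ᵇ b ⟧ * h b) ≡ ⟦ u <ᵇ n ⟧ * h u
∑-upTo-indicator zero    u       h = refl
∑-upTo-indicator (suc n) zero    h = begin
  ∑ (upTo (suc n)) (λ b → ⟦ 0 ≡ᵇ b ⟧ * h b)             ≡⟨ ∑-upTo-suc n (λ b → ⟦ 0 ≡ᵇ b ⟧ * h b) ⟩
  h 0 + 0 + ∑ (upTo n) (λ b → ⟦ 0 ≡ᵇ suc b ⟧ * h (suc b)) ≡⟨ cong (h 0 + 0 +_) (∑-0 (upTo n)) ⟩
  h 0 + 0 + 0                                            ≡⟨ +-identityʳ _ ⟩
  h 0 + 0                                                ∎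
∑-upTo-indicator (suc n) (suc u) h =
  trans (∑-upTo-suc n (λ b → ⟦ suc u ≡ᵇ b ⟧ * h b)) (∑-upTo-indicator n u (λ b → h (suc b)))

split-arith : ∀ u₀ w₀ x → ⟦ u₀ <ᵇ suc x ⟧ * ⟦ w₀ ≡ᵇ x ∸ u₀ ⟧ ≡ ⟦ u₀ + w₀ ≡ᵇ x ⟧
split-arith zero    w₀ x       = +-identityʳ _
split-arith (suc u₀) w₀ zero    = refl
split-arith (suc u₀) w₀ (suc x) = split-arith u₀ w₀ x

∑-splits-∷ : {k : ℕ} (x : ℕ) (xs : Vec ℕ k) (F : Vec ℕ (suc k) × Vec ℕ (suc k) → ℕ) →
  ∑ (splits (x ∷ xs)) F ≡ ∑ (upTo (suc x)) (λ b → ∑ (splits xs) (λ p → F (b ∷ proj₁ p , (x ∸ b) ∷ proj₂ p)))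
∑-splits-∷ {k} x xs F = trans (∑-concatMap (λ b → map (extend b) (splits xs)) (upTo (suc x)) F)
                          (∑-cong (upTo (suc x)) (λ b → ∑-map (extend b) (splits xs) F))
  where
  extend : ℕ → Vec ℕ k × Vec ℕ k → Vec ℕ (suc k) × Vec ℕ (suc k)
  extend b p = (b ∷ proj₁ p , (x ∸ b) ∷ proj₂ p)

-- Exactly one way of writing a = b + c has (b , c) = (u , w), provided u + w = a:
-- this is why convolution of coefficients multiplies monomials.
splits-indicator : {k : ℕ} (a u w : Vec ℕ k) →
  ∑ (splits a) (λ p → ⟦ vecEqᵇ u (proj₁ p) ⟧ * ⟦ vecEqᵇ w (proj₂ p) ⟧) ≡ ⟦ vecEqᵇ (u +ᵛ w) a ⟧
splits-indicator [] [] [] = refl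
splits-indicator {suc k} (x ∷ xs) (u₀ ∷ us) (w₀ ∷ ws) = begin
  ∑ (splits (x ∷ xs)) (λ p → ⟦ vecEqᵇ (u₀ ∷ us) (proj₁ p) ⟧ * ⟦ vecEqᵇ (w₀ ∷ ws) (proj₂ p) ⟧)
    ≡⟨ ∑-splits-∷ x xs _ ⟩
  ∑ (upTo (suc x)) (λ b → ∑ (splits xs) (λ p →
      ⟦ (u₀ ≡ᵇ b) ∧ vecEqᵇ us (proj₁ p) ⟧ * ⟦ (w₀ ≡ᵇ x ∸ b) ∧ vecEqᵇ ws (proj₂ p) ⟧))
    ≡⟨ ∑-cong (upTo (suc x)) (λ b → ∑-cong (splits xs) (separate b)) ⟩
  ∑ (upTo (suc x)) (λ b → ∑ (splits xs) (λ p → (δu b * δw b) * G p))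
    ≡⟨ ∑-cong (upTo (suc x)) (λ b → trans (∑-*ˡ (splits xs) (δu b * δw b) G) (*-assoc (δu b) _ _)) ⟩
  ∑ (upTo (suc x)) (λ b → δu b * (δw b * ∑ (splits xs) G))
    ≡⟨ ∑-upTo-indicator (suc x) u₀ _ ⟩
  ⟦ u₀ <ᵇ suc x ⟧ * (δw u₀ * ∑ (splits xs) G)
    ≡⟨ sym (*-assoc ⟦ u₀ <ᵇ suc x ⟧ _ _) ⟩
  ⟦ u₀ <ᵇ suc x ⟧ * δw u₀ * ∑ (splits xs) G
    ≡⟨ cong₂ _*_ (split-arith u₀ w₀ x) (splits-indicator xs us ws) ⟩
  ⟦ u₀ + w₀ ≡ᵇ x ⟧ * ⟦ vecEqᵇ (us +ᵛ ws) xs ⟧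
    ≡⟨ sym (⟦∧⟧ (u₀ + w₀ ≡ᵇ x) _) ⟩
  ⟦ vecEqᵇ ((u₀ ∷ us) +ᵛ (w₀ ∷ ws)) (x ∷ xs) ⟧ ∎
  where
  δu δw : ℕ → ℕ
  δu b = ⟦ u₀ ≡ᵇ b ⟧
  δw b = ⟦ w₀ ≡ᵇ x ∸ b ⟧
  G : Vec ℕ k × Vec ℕ k → ℕ
  G p = ⟦ vecEqᵇ us (proj₁ p) ⟧ * ⟦ vecEqᵇ ws (proj₂ p) ⟧
  separate : ∀ b p → ⟦ (u₀ ≡ᵇ b) ∧ vecEqᵇ us (proj₁ p) ⟧ * ⟦ (w₀ ≡ᵇ x ∸ b) ∧ vecEqᵇ ws (proj₂ p) ⟧
                   ≡ (δu b * δw b) * G p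
  separate b p = trans (cong₂ _*_ (⟦∧⟧ (u₀ ≡ᵇ b) _) (⟦∧⟧ (w₀ ≡ᵇ x ∸ b) _)) (*-interchange (δu b) _ _ _)

glue-colourings : (N₁ N₂ : ℕ) (A₁ A₂ : ℕ → ℕ → Bool) {k : ℕ} (a : Vec ℕ k)
  (u : Vec (Fin k) N₁) (w : Vec (Fin k) N₂) →
  ∑ (splits a) (λ p → ⟦ properOfType N₁ A₁ (proj₁ p) u ⟧ * ⟦ properOfType N₂ A₂ (proj₂ p) w ⟧)
    ≡ ⟦ properOfType (N₁ + N₂) (disjointAdj N₁ A₁ A₂) a (u ++ w) ⟧
glue-colourings N₁ N₂ A₁ A₂ {k} a u w = begin
  ∑ (splits a) (λ p → ⟦ ok₁ ∧ type₁ p ⟧ * ⟦ ok₂ ∧ type₂ p ⟧)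
    ≡⟨ ∑-cong (splits a) (λ p → trans (cong₂ _*_ (⟦∧⟧ ok₁ _) (⟦∧⟧ ok₂ _)) (*-interchange ⟦ ok₁ ⟧ _ _ _)) ⟩
  ∑ (splits a) (λ p → (⟦ ok₁ ⟧ * ⟦ ok₂ ⟧) * (⟦ type₁ p ⟧ * ⟦ type₂ p ⟧))
    ≡⟨ ∑-*ˡ (splits a) (⟦ ok₁ ⟧ * ⟦ ok₂ ⟧) _ ⟩
  (⟦ ok₁ ⟧ * ⟦ ok₂ ⟧) * ∑ (splits a) (λ p → ⟦ type₁ p ⟧ * ⟦ type₂ p ⟧)
    ≡⟨ cong₂ _*_ (sym (⟦∧⟧ ok₁ ok₂)) (splits-indicator a (colourType u) (colourType w)) ⟩
  ⟦ ok₁ ∧ ok₂ ⟧ * ⟦ vecEqᵇ (colourType u +ᵛ colourType w) a ⟧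
    ≡⟨ sym (⟦∧⟧ (ok₁ ∧ ok₂) _) ⟩
  ⟦ (ok₁ ∧ ok₂) ∧ vecEqᵇ (colourType u +ᵛ colourType w) a ⟧
    ≡⟨ sym (cong₂ (λ b t → ⟦ b ∧ vecEqᵇ t a ⟧) (proper-disjoint N₁ N₂ A₁ A₂ u w) (colourType-++ u w)) ⟩
  ⟦ isProper (graphOn (N₁ + N₂) (disjointAdj N₁ A₁ A₂)) (u ++ w) ∧ vecEqᵇ (colourType (u ++ w)) a ⟧ ∎
  where
  ok₁ ok₂ : Bool
  ok₁ = isProper (graphOn N₁ A₁) u
  ok₂ = isProper (graphOn N₂ A₂) w
  type₁ type₂ : Vec ℕ k × Vec ℕ k → Bool
  type₁ p = vecEqᵇ (colourType u) (proj₁ p)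
  type₂ p = vecEqᵇ (colourType w) (proj₂ p)

∑ℤ-pos : {B : Set} (xs : List B) (F : B → ℤ) (h : B → ℕ) → (∀ p → F p ≡ pos (h p)) →
  List.foldr _+ℤ_ (pos 0) (map F xs) ≡ pos (∑ xs h)
∑ℤ-pos []       F h e = refl
∑ℤ-pos (x ∷ xs) F h e = trans (cong₂ _+ℤ_ (e x) (∑ℤ-pos xs F h e)) (sym (ℤ.pos-+ (h x) _))

X-disjoint-union : (N₁ N₂ : ℕ) (A₁ A₂ : ℕ → ℕ → Bool) →
  (X (graphOn N₁ A₁) ⊗ X (graphOn N₂ A₂)) ≈ₛ X (graphOn (N₁ + N₂) (disjointAdj N₁ A₁ A₂))
X-disjoint-union N₁ N₂ A₁ A₂ k a = begin
  (X (graphOn N₁ A₁) ⊗ X (graphOn N₂ A₂)) k a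
    ≡⟨ ∑ℤ-pos (splits a) _ _ (λ p → trans (cong₂ _*ℤ_ (X-#proper N₁ A₁ k (proj₁ p)) (X-#proper N₂ A₂ k (proj₂ p)))
                                           (sym (ℤ.pos-* (#proper N₁ A₁ k (proj₁ p)) _))) ⟩
  pos (∑ (splits a) (λ p → #proper N₁ A₁ k (proj₁ p) * #proper N₂ A₂ k (proj₂ p)))
    ≡⟨ cong pos counts ⟩
  pos (#proper (N₁ + N₂) D k a)
    ≡⟨ sym (X-#proper (N₁ + N₂) D k a) ⟩
  X (graphOn (N₁ + N₂) D) k a ∎
  where
  D : ℕ → ℕ → Bool
  D = disjointAdj N₁ A₁ A₂
  pair : Vec (Fin k) N₁ → Vec (Fin k) N₂ → Vec ℕ k × Vec ℕ k → ℕ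
  pair u w p = ⟦ properOfType N₁ A₁ (proj₁ p) u ⟧ * ⟦ properOfType N₂ A₂ (proj₂ p) w ⟧
  counts : ∑ (splits a) (λ p → #proper N₁ A₁ k (proj₁ p) * #proper N₂ A₂ k (proj₂ p)) ≡ #proper (N₁ + N₂) D k a
  counts = begin
    ∑ (splits a) (λ p → #proper N₁ A₁ k (proj₁ p) * #proper N₂ A₂ k (proj₂ p))
      ≡⟨ ∑-cong (splits a) (λ p → ∑-*-∑ (allVecs N₁ k) (allVecs N₂ k) _ _) ⟩
    ∑ (splits a) (λ p → ∑ⱽ N₁ (λ u → ∑ⱽ N₂ (λ w → pair u w p)))
      ≡⟨ sym (∑-comm (allVecs N₁ k) (splits a) _) ⟩
    ∑ⱽ N₁ (λ u → ∑ (splits a) (λ p → ∑ⱽ N₂ (λ w → pair u w p)))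
      ≡⟨ ∑-cong (allVecs N₁ k) (λ u → sym (∑-comm (allVecs N₂ k) (splits a) _)) ⟩
    ∑ⱽ N₁ (λ u → ∑ⱽ N₂ (λ w → ∑ (splits a) (pair u w)))
      ≡⟨ ∑-cong (allVecs N₁ k) (λ u → ∑-cong (allVecs N₂ k) (glue-colourings N₁ N₂ A₁ A₂ a u)) ⟩
    ∑ⱽ N₁ (λ u → ∑ⱽ N₂ (λ w → ⟦ properOfType (N₁ + N₂) D a (u ++ w) ⟧))
      ≡⟨ sym (∑ⱽ-++ N₁ N₂ _) ⟩
    #proper (N₁ + N₂) D k a ∎

-- A vertex seen by a clique: the counting argument

none : (ℕ → Bool) → ℕ → Bool
none d zero    = true
none d (suc r) = none d r ∧ not (d r)

none-true : ∀ (d : ℕ → Bool) r → none d r ≡ true → ∀ i → i < r → d i ≡ false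
none-true d (suc r) ok i i<1+r with d r in e | m<1+n⇒m<n∨m≡n i<1+r
... | true  | _          = ⊥-elim (false≢true (trans (sym (∧-zeroʳ (none d r))) ok))
... | false | inj₁ i<r   = none-true d r (trans (sym (∧-identityʳ (none d r))) ok) i i<r
... | false | inj₂ refl  = e

none-intro : ∀ (d : ℕ → Bool) r → (∀ i → i < r → d i ≡ false) → none d r ≡ true
none-intro d zero    h = refl
none-intro d (suc r) h rewrite h r ≤-refl | none-intro d r (λ i i<r → h i (m<n⇒m<1+n i<r)) = refl

AtMostOne : (ℕ → Bool) → ℕ → Set
AtMostOne d r = ∀ i i' → i < r → i' < r → i ≢ i' → d i ≡ true → d i' ≡ true → ⊥

at-most-one-shrink : ∀ (d : ℕ → Bool) r → AtMostOne d (suc r) → AtMostOne d r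
at-most-one-shrink d r once i i' i<r i'<r = once i i' (m<n⇒m<1+n i<r) (m<n⇒m<1+n i'<r)

at-most-one-below : ∀ (d : ℕ → Bool) r → AtMostOne d (suc r) → d r ≡ true → ∀ i → i < r → d i ≡ false
at-most-one-below d r once dr i i<r with d i in di
... | false = refl
... | true  = ⊥-elim (once i r (m<n⇒m<1+n i<r) ≤-refl (<⇒≢ i<r) di dr)

∑<-false : ∀ r (d : ℕ → Bool) → (∀ i → i < r → d i ≡ false) → ∑< r (λ i → ⟦ d i ⟧) ≡ 0
∑<-false r d h = trans (∑<-cong r (λ i i<r → cong ⟦_⟧ (h i i<r))) (∑<-0 r)

none-or-one : ∀ r (d : ℕ → Bool) → AtMostOne d r → ⟦ none d r ⟧ + ∑< r (λ i → ⟦ d i ⟧) ≡ 1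
none-or-one zero    d once = refl
none-or-one (suc r) d once with d r in dr
... | true  rewrite ∧-zeroʳ (none d r) | ∑<-false r d (at-most-one-below d r once dr) = refl
... | false rewrite ∧-identityʳ (none d r) | +-identityʳ (∑< r (λ i → ⟦ d i ⟧)) =
  none-or-one r d (at-most-one-shrink d r once)

not-last : ∀ j (d : ℕ → Bool) → AtMostOne d (suc j) → ⟦ not (d j) ⟧ ≡ ⟦ none d (suc j) ⟧ + ∑< j (λ i → ⟦ d i ⟧)
not-last j d once with d j in dj
... | true  rewrite ∧-zeroʳ (none d j) | ∑<-false j d (at-most-one-below d j once dj) = refl
... | false rewrite ∧-identityʳ (none d j) = sym (none-or-one j d (at-most-one-shrink d j once))

split-none-or-one : ∀ h (d : ℕ → Bool) r → (h ≡ true → AtMostOne d r) →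
  ⟦ h ⟧ ≡ ⟦ h ∧ none d r ⟧ + ∑< r (λ i → ⟦ h ∧ d i ⟧)
split-none-or-one false d r once = sym (∑<-0 r)
split-none-or-one true  d r once = sym (none-or-one r d (once refl))

split-not-last : ∀ h (d : ℕ → Bool) j → (h ≡ true → AtMostOne d (suc j)) →
  ⟦ h ∧ not (d j) ⟧ ≡ ⟦ h ∧ none d (suc j) ⟧ + ∑< j (λ i → ⟦ h ∧ d i ⟧)
split-not-last false d j once = sym (∑<-0 j)
split-not-last true  d j once = not-last j d (once refl)

starAdj : ℕ → ℕ → ℕ → Bool
starAdj v x y = ((x ≡ᵇ v) ∧ (y <ᵇ v)) ∨ ((y ≡ᵇ v) ∧ (x <ᵇ v))

edgeAdj : ℕ → ℕ → ℕ → Bool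
edgeAdj j x y = ((x ≡ᵇ j) ∧ (y ≡ᵇ suc j)) ∨ ((y ≡ᵇ j) ∧ (x ≡ᵇ suc j))

matches : {k N : ℕ} → ℕ → Vec (Fin k) N → ℕ → Bool
matches v κ i = colourOf κ i ≡ᵇ colourOf κ v

proper-star : {k : ℕ} (N v : ℕ) → v < N → (κ : Vec (Fin k) N) →
  isProper (graphOn N (starAdj v)) κ ≡ none (matches v κ) v
proper-star N v v<N κ = bool-ext _ _ forward backward
  where
  forward : isProper (graphOn N (starAdj v)) κ ≡ true → none (matches v κ) v ≡ true
  forward ok = none-intro _ v differs
    where
    differs : ∀ i → i < v → matches v κ i ≡ false
    differs i i<v with matches v κ i in same
    ... | false = refl
    ... | true  = ⊥-elim (isProper⇒Proper N (starAdj v) κ ok v i v<N (<-trans i<v v<N) edge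
                            (sym (≡ᵇ⇒≡′ _ _ same)))
      where
      edge : starAdj v v i ≡ true
      edge rewrite ≡⇒≡ᵇ′ v v refl | <⇒<ᵇ′ i<v = refl
  backward : none (matches v κ) v ≡ true → isProper (graphOn N (starAdj v)) κ ≡ true
  backward ok = Proper⇒isProper N (starAdj v) κ proper
    where
    differs : ∀ i → i < v → matches v κ i ≡ false
    differs = none-true _ v ok
    proper : Proper N (starAdj v) (colourOf κ)
    proper x y _ _ edge same with ∨-elim ((x ≡ᵇ v) ∧ (y <ᵇ v)) edge
    ... | inj₁ x=v∧y<v rewrite ≡ᵇ⇒≡′ x v (∧-elimˡ x=v∧y<v) =
      false≢true (trans (sym (differs y (<ᵇ⇒<′ y v (∧-elimʳ x=v∧y<v)))) (≡⇒≡ᵇ′ _ _ (sym same)))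
    ... | inj₂ y=v∧x<v rewrite ≡ᵇ⇒≡′ y v (∧-elimˡ y=v∧x<v) =
      false≢true (trans (sym (differs x (<ᵇ⇒<′ x v (∧-elimʳ y=v∧x<v)))) (≡⇒≡ᵇ′ _ _ same))

proper-edge : {k : ℕ} (N j : ℕ) → suc j < N → (κ : Vec (Fin k) N) →
  isProper (graphOn N (edgeAdj j)) κ ≡ not (matches (suc j) κ j)
proper-edge N j 1+j<N κ = bool-ext _ _ forward backward
  where
  forward : isProper (graphOn N (edgeAdj j)) κ ≡ true → not (matches (suc j) κ j) ≡ true
  forward ok with matches (suc j) κ j in same
  ... | false = refl
  ... | true  = ⊥-elim (isProper⇒Proper N (edgeAdj j) κ ok j (suc j) (<-trans (n<1+n j) 1+j<N) 1+j<N edge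
                          (≡ᵇ⇒≡′ _ _ same))
    where
    edge : edgeAdj j j (suc j) ≡ true
    edge rewrite ≡⇒≡ᵇ′ j j refl = refl
  backward : not (matches (suc j) κ j) ≡ true → isProper (graphOn N (edgeAdj j)) κ ≡ true
  backward ok = Proper⇒isProper N (edgeAdj j) κ proper
    where
    differs : matches (suc j) κ j ≡ false
    differs = trans (sym (not-involutive _)) (cong not ok)
    proper : Proper N (edgeAdj j) (colourOf κ)
    proper x y _ _ edge same with ∨-elim ((x ≡ᵇ j) ∧ (y ≡ᵇ suc j)) edge
    ... | inj₁ x=j∧y=1+j rewrite ≡ᵇ⇒≡′ x j (∧-elimˡ x=j∧y=1+j) | ≡ᵇ⇒≡′ y (suc j) (∧-elimʳ x=j∧y=1+j) =
      false≢true (trans (sym differs) (≡⇒≡ᵇ′ _ _ same))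
    ... | inj₂ y=j∧x=1+j rewrite ≡ᵇ⇒≡′ y j (∧-elimˡ y=j∧x=1+j) | ≡ᵇ⇒≡′ x (suc j) (∧-elimʳ y=j∧x=1+j) =
      false≢true (trans (sym differs) (≡⇒≡ᵇ′ _ _ (sym same)))

clique-at-most-one : {k : ℕ} (N v : ℕ) (A : ℕ → ℕ → Bool) → v ≤ N →
  (∀ i i' → i < v → i' < v → i ≢ i' → A i i' ≡ true) →
  (κ : Vec (Fin k) N) → isProper (graphOn N A) κ ≡ true → AtMostOne (matches v κ) v
clique-at-most-one N v A v≤N clique κ ok i i' i<v i'<v i≢i' same same' =
  isProper⇒Proper N A κ ok i i' (<-≤-trans i<v v≤N) (<-≤-trans i'<v v≤N) (clique i i' i<v i'<v i≢i')
    (trans (≡ᵇ⇒≡′ _ _ same) (sym (≡ᵇ⇒≡′ _ _ same')))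

module Attachment (N j : ℕ) (A S E : ℕ → ℕ → Bool) (1+j<N : suc j < N)
  (clique : ∀ i i' → i < suc j → i' < suc j → i ≢ i' → A i i' ≡ true)
  (symmetric : ∀ i → suc i < suc j → ∀ x y → A (τ i x) (τ i y) ≡ A x y)
  (S-def : ∀ x y → S x y ≡ (A x y ∨ starAdj (suc j) x y))
  (E-def : ∀ x y → E x y ≡ (A x y ∨ edgeAdj j x y))
  (k : ℕ) (a : Vec ℕ k) where

  v : ℕ
  v = suc j

  good : Vec (Fin k) N → Bool
  good = properOfType N A a

  B : ℕ → ℕ
  B i = ∑ⱽ N (λ κ → ⟦ good κ ∧ matches v κ i ⟧)

  once : ∀ κ → good κ ≡ true → AtMostOne (matches v κ) v
  once κ ok = clique-at-most-one N v A (<⇒≤ 1+j<N) clique κ (∧-elimˡ ok)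

  good-∪ : (F A∪F : ℕ → ℕ → Bool) → (∀ x y → A∪F x y ≡ (A x y ∨ F x y)) → ∀ κ →
    properOfType N A∪F a κ ≡ (good κ ∧ isProper (graphOn N F) κ)
  good-∪ F A∪F union κ = trans (cong (_∧ vecEqᵇ (colourType κ) a) (proper-∪ N A F A∪F union κ))
                               (∧-swapʳ (isProper (graphOn N A) κ) _ _)

  S-good : ∀ κ → properOfType N S a κ ≡ (good κ ∧ none (matches v κ) v)
  S-good κ = trans (good-∪ (starAdj v) S S-def κ) (cong (good κ ∧_) (proper-star N v 1+j<N κ))

  E-good : ∀ κ → properOfType N E a κ ≡ (good κ ∧ not (matches v κ j))
  E-good κ = trans (good-∪ (edgeAdj j) E E-def κ) (cong (good κ ∧_) (proper-edge N j 1+j<N κ))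

  count-split : (P : Vec (Fin k) N → Bool) (r : ℕ) →
    (∀ κ → ⟦ P κ ⟧ ≡ ⟦ good κ ∧ none (matches v κ) v ⟧ + ∑< r (λ i → ⟦ good κ ∧ matches v κ i ⟧)) →
    ∑ⱽ N (λ κ → ⟦ P κ ⟧) ≡ #proper N S k a + ∑< r B
  count-split P r split = begin
    ∑ⱽ N (λ κ → ⟦ P κ ⟧)
      ≡⟨ ∑-cong (allVecs N k) split ⟩
    ∑ⱽ N (λ κ → ⟦ good κ ∧ none (matches v κ) v ⟧ + ∑< r (λ i → ⟦ good κ ∧ matches v κ i ⟧))
      ≡⟨ ∑-+ (allVecs N k) _ _ ⟩
    ∑ⱽ N (λ κ → ⟦ good κ ∧ none (matches v κ) v ⟧) + ∑ⱽ N (λ κ → ∑< r (λ i → ⟦ good κ ∧ matches v κ i ⟧))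
      ≡⟨ cong₂ _+_ (∑-cong (allVecs N k) (λ κ → cong ⟦_⟧ (sym (S-good κ))))
                   (∑-∑< (allVecs N k) r (λ i κ → ⟦ good κ ∧ matches v κ i ⟧)) ⟩
    #proper N S k a + ∑< r B ∎

  count-A : #proper N A k a ≡ #proper N S k a + ∑< v B
  count-A = count-split good v (λ κ → split-none-or-one (good κ) (matches v κ) v (once κ))

  count-E : #proper N E k a ≡ #proper N S k a + ∑< j B
  count-E = count-split (properOfType N E a) j
    (λ κ → trans (cong ⟦_⟧ (E-good κ)) (split-not-last (good κ) (matches v κ) j (once κ)))

  -- Transposing the clique vertices i, i+1 exchanges B i and B (i+1).
  B-step : ∀ i → suc i < v → B (suc i) ≡ B i
  B-step i 1+i<v = trans (∑ⱽ-swap N i _) (∑-cong (allVecs N k) swapped)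
    where
    1+i<N : suc i < N
    1+i<N = <-trans 1+i<v 1+j<N
    good-swap : ∀ κ → good (swapAt i κ) ≡ good κ
    good-swap κ = cong₂ _∧_ (proper-swap N A i 1+i<N (symmetric i 1+i<v) κ)
                            (cong (λ t → vecEqᵇ t a) (colourType-swap i κ))
    matches-swap : ∀ κ → matches v (swapAt i κ) (suc i) ≡ matches v κ i
    matches-swap κ = cong₂ _≡ᵇ_
      (trans (colourOf-swap i (suc i) κ 1+i<N) (cong (colourOf κ) (τ-left i)))
      (trans (colourOf-swap i v κ 1+i<N)
             (cong (colourOf κ) (τ-fixes i v (λ v=i → <⇒≢ (<-trans (n<1+n i) 1+i<v) (sym v=i))
                                             (λ v=1+i → <⇒≢ 1+i<v (sym v=1+i)))))
    swapped : ∀ κ → ⟦ good (swapAt i κ) ∧ matches v (swapAt i κ) (suc i) ⟧ ≡ ⟦ good κ ∧ matches v κ i ⟧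
    swapped κ = cong ⟦_⟧ (cong₂ _∧_ (good-swap κ) (matches-swap κ))

  B-constant : ∀ i → i < v → B i ≡ B 0
  B-constant zero    _     = refl
  B-constant (suc i) 1+i<v = trans (B-step i 1+i<v) (B-constant i (<-trans (n<1+n i) 1+i<v))

  result : #proper N S k a + j * #proper N A k a ≡ suc j * #proper N E k a
  result = begin
    L + j * #proper N A k a
      ≡⟨ cong (λ c → L + j * c) (trans count-A (cong (L +_) (∑<-const v B (B 0) B-constant))) ⟩
    L + j * (L + suc j * B 0)
      ≡⟨ eliminate L (B 0) j ⟩
    suc j * (L + j * B 0)
      ≡⟨ cong (suc j *_) (sym (trans count-E (cong (L +_) (∑<-const j B (B 0) below-j)))) ⟩
    suc j * #proper N E k a ∎
    where
    L : ℕ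
    L = #proper N S k a
    below-j : ∀ i → i < j → B i ≡ B 0
    below-j i i<j = B-constant i (<-trans i<j (n<1+n j))
    eliminate : ∀ L B j → L + j * (L + suc j * B) ≡ suc j * (L + j * B)
    eliminate = solve-∀

clique-attachment : (N j : ℕ) (A S E : ℕ → ℕ → Bool) → suc j < N →
  (∀ i i' → i < suc j → i' < suc j → i ≢ i' → A i i' ≡ true) →
  (∀ i → suc i < suc j → ∀ x y → A (τ i x) (τ i y) ≡ A x y) →
  (∀ x y → S x y ≡ (A x y ∨ starAdj (suc j) x y)) →
  (∀ x y → E x y ≡ (A x y ∨ edgeAdj j x y)) →
  (k : ℕ) (a : Vec ℕ k) →
  #proper N S k a + j * #proper N A k a ≡ suc j * #proper N E k a
clique-attachment = Attachment.result

-- Lollipops as a clique beside a path plus edges at the path end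

distinct : ℕ → ℕ → Bool
distinct x y = not (x ≡ᵇ y)

cliquePath : ℕ → ℕ → ℕ → Bool
cliquePath v = disjointAdj v distinct consecutive

cliquePath-clique : ∀ v i i' → i < v → i' < v → i ≢ i' → cliquePath v i i' ≡ true
cliquePath-clique v i i' i<v i'<v i≢i' rewrite <⇒<ᵇ′ i<v | <⇒<ᵇ′ i'<v | ≢⇒≡ᵇ-false i i' i≢i' = refl

τ-<ᵇ : ∀ i N x → suc i < N → (τ i x <ᵇ N) ≡ (x <ᵇ N)
τ-<ᵇ i N x 1+i<N = bool-ext _ _
  (λ τx<N → <⇒<ᵇ′ (subst (_< N) (τ-involutive i x) (τ-< i (τ i x) N 1+i<N (<ᵇ⇒<′ _ _ τx<N))))
  (λ x<N → <⇒<ᵇ′ (τ-< i x N 1+i<N (<ᵇ⇒<′ _ _ x<N)))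

cliquePath-τ : ∀ v i → suc i < v → ∀ x y → cliquePath v (τ i x) (τ i y) ≡ cliquePath v x y
cliquePath-τ (suc (suc v)) zero _ zero zero = refl
cliquePath-τ (suc (suc v)) zero _ zero (suc zero) = refl
cliquePath-τ (suc (suc v)) zero _ zero (suc (suc y)) = refl
cliquePath-τ (suc (suc v)) zero _ (suc zero) zero = refl
cliquePath-τ (suc (suc v)) zero _ (suc zero) (suc zero) = refl
cliquePath-τ (suc (suc v)) zero _ (suc zero) (suc (suc y)) = refl
cliquePath-τ (suc (suc v)) zero _ (suc (suc x)) zero = refl
cliquePath-τ (suc (suc v)) zero _ (suc (suc x)) (suc zero) = refl
cliquePath-τ (suc (suc v)) zero _ (suc (suc x)) (suc (suc y)) = refl
cliquePath-τ (suc v) (suc i) (s≤s 1+i<v) zero zero = refl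
cliquePath-τ (suc v) (suc i) (s≤s 1+i<v) zero (suc y) rewrite τ-<ᵇ i v y 1+i<v = refl
cliquePath-τ (suc v) (suc i) (s≤s 1+i<v) (suc x) zero rewrite τ-<ᵇ i v x 1+i<v = refl
cliquePath-τ (suc v) (suc i) (s≤s 1+i<v) (suc x) (suc y) = cliquePath-τ v i 1+i<v x y

<ᵇ-suc : ∀ y m → (y <ᵇ suc m) ≡ ((y <ᵇ m) ∨ (y ≡ᵇ m))
<ᵇ-suc zero    zero    = refl
<ᵇ-suc zero    (suc m) = refl
<ᵇ-suc (suc y) zero    = refl
<ᵇ-suc (suc y) (suc m) = <ᵇ-suc y m

∧-true≡∨-false : ∀ b → (b ∧ true) ≡ (b ∨ false)
∧-true≡∨-false true  = refl
∧-true≡∨-false false = refl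

lollipop-star : ∀ m x y → lollipopAdj (suc m) x y ≡ (cliquePath m x y ∨ starAdj m x y)
lollipop-star zero zero zero = refl
lollipop-star zero zero (suc y) with 0 ≡ᵇ y
... | true = refl
... | false = refl
lollipop-star zero (suc x) zero with 0 ≡ᵇ x
... | true = refl
... | false = refl
lollipop-star zero (suc x) (suc y) = ∧-true≡∨-false _
lollipop-star (suc m) zero zero = refl
lollipop-star (suc zero) zero (suc zero) = refl
lollipop-star (suc (suc m)) zero (suc zero) = refl
lollipop-star (suc zero) zero (suc (suc y)) = refl
lollipop-star (suc (suc m)) zero (suc (suc y)) rewrite <ᵇ-suc y m with y <ᵇ m | y ≡ᵇ m
... | true | _ = refl
... | false | true = refl
... | false | false = refl
lollipop-star (suc zero) (suc zero) zero = refl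
lollipop-star (suc (suc m)) (suc zero) zero = refl
lollipop-star (suc zero) (suc (suc x)) zero = refl
lollipop-star (suc (suc m)) (suc (suc x)) zero rewrite <ᵇ-suc x m with x <ᵇ m | x ≡ᵇ m
... | true | _ = refl
... | false | true = refl
... | false | false = refl
lollipop-star (suc m) (suc x) (suc y) = lollipop-star m x y

lollipop-edge : ∀ m x y → lollipopAdj (suc m) x y ≡ (cliquePath (suc m) x y ∨ edgeAdj m x y)
lollipop-edge zero zero zero = refl
lollipop-edge zero zero (suc zero) = refl
lollipop-edge zero zero (suc (suc y)) = refl
lollipop-edge zero (suc zero) zero = refl
lollipop-edge zero (suc (suc x)) zero = refl
lollipop-edge zero (suc x) (suc y) = ∧-true≡∨-false _
lollipop-edge (suc m) zero zero = refl
lollipop-edge (suc m) zero (suc zero) = refl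
lollipop-edge (suc m) zero (suc (suc y)) with y <ᵇ m | suc y ≡ᵇ m
... | true | true = refl
... | true | false = refl
... | false | true = refl
... | false | false = refl
lollipop-edge (suc m) (suc zero) zero = refl
lollipop-edge (suc m) (suc (suc x)) zero with x <ᵇ m | suc x ≡ᵇ m
... | true | true = refl
... | true | false = refl
... | false | true = refl
... | false | false = refl
lollipop-edge (suc m) (suc x) (suc y) = lollipop-edge m x y

lollipop-counts : ∀ j n k (a : Vec ℕ k) →
  #proper (suc j + suc n) (lollipopAdj (suc (suc j))) k a + j * #proper (suc j + suc n) (cliquePath (suc j)) k a
    ≡ suc j * #proper (suc j + suc n) (lollipopAdj (suc j)) k a
lollipop-counts j n =
  clique-attachment (suc j + suc n) j (cliquePath (suc j)) (lollipopAdj (suc (suc j))) (lollipopAdj (suc j))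
    (m<m+n (suc j) z<s) (cliquePath-clique (suc j)) (cliquePath-τ (suc j))
    (lollipop-star (suc j)) (lollipop-edge j)

X-#proper-resize : ∀ {N N′} (A : ℕ → ℕ → Bool) k (a : Vec ℕ k) → N ≡ N′ →
  X (graphOn N A) k a ≡ pos (#proper N′ A k a)
X-#proper-resize {N} A k a refl = X-#proper N A k a

pos-difference : ∀ b c d → b + c ≡ d → pos b ≡ pos d -ℤ pos c
pos-difference b c d refl = sym (begin
  pos (b + c) -ℤ pos c          ≡⟨ cong (_-ℤ pos c) (ℤ.pos-+ b c) ⟩
  pos b +ℤ pos c -ℤ pos c       ≡⟨ ℤ.+-assoc (pos b) (pos c) (-ℤ pos c) ⟩
  pos b +ℤ (pos c -ℤ pos c)     ≡⟨ cong (pos b +ℤ_) (ℤ.+-inverseʳ (pos c)) ⟩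
  pos b +ℤ pos 0                ≡⟨ ℤ.+-identityʳ (pos b) ⟩
  pos b                         ∎)

open import Data.Integer using (+_)

theorem3p2 : (m n : ℕ) → 2 ≤ m →
    X (Lollipop m n) ≈ₛ
      ((+ (m ∸ 1)) · X (Lollipop (m ∸ 1) (n + 1))
        ⊖ (+ (m ∸ 2)) · (X (K (m ∸ 1)) ⊗ X (P (n + 1))))
theorem3p2 (suc (suc j)) n (s≤s (s≤s z≤n)) k a = begin
  X (Lollipop (suc (suc j)) n) k a
    ≡⟨ X-#proper-resize (lollipopAdj (suc (suc j))) k a (sym (+-suc (suc j) n)) ⟩
  + Lₘₙ
    ≡⟨ pos-difference Lₘₙ (j * H) (suc j * L′) (lollipop-counts j n k a) ⟩
  + (suc j * L′) -ℤ + (j * H)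
    ≡⟨ cong₂ _-ℤ_ (ℤ.pos-* (suc j) L′) (ℤ.pos-* j H) ⟩
  + suc j *ℤ + L′ -ℤ + j *ℤ + H
    ≡⟨ cong₂ (λ x y → + suc j *ℤ x -ℤ + j *ℤ y) (sym X-L′) (sym X-H) ⟩
  (+ suc j *ℤ X (Lollipop (suc j) (n + 1)) k a) -ℤ (+ j *ℤ (X (K (suc j)) ⊗ X (P (n + 1))) k a) ∎
  where
  N : ℕ
  N = suc j + suc n
  n+1≡1+n : suc j + (n + 1) ≡ N
  n+1≡1+n = cong (λ r → suc j + r) (+-comm n 1)
  Lₘₙ L′ H : ℕ
  Lₘₙ = #proper N (lollipopAdj (suc (suc j))) k a
  L′  = #proper N (lollipopAdj (suc j)) k a
  H   = #proper N (cliquePath (suc j)) k a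
  X-L′ : X (Lollipop (suc j) (n + 1)) k a ≡ + L′
  X-L′ = X-#proper-resize (lollipopAdj (suc j)) k a n+1≡1+n
  X-H : (X (K (suc j)) ⊗ X (P (n + 1))) k a ≡ + H
  X-H = trans (X-disjoint-union (suc j) (n + 1) distinct consecutive k a)
              (X-#proper-resize (cliquePath (suc j)) k a n+1≡1+n)
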